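{- Let $d\ge 2$ and $n\ge 2$ be integers such that $n$ is odd, or $n$ is even and $d>2$. Then $$S=\mathcal A_d^n\setminus\{x\in\mathcal A_d^n : x_1=x_n\}$$ (i.e. $\mathcal A_d^n$ minus all strings $a\oplus w\oplus a$ with $a\in\mathcal A_d$, $w\in\mathcal A_d^{n-2}$) is a $1$-identifying code of $\vec{\mathcal B}(d,n)$, and it has size $(d-1)d^{n-1}$, the minimum possible size of a $1$-identifying code of $\vec{\mathcal B}(d,n)$.
   Context: $\mathcal A_d=\{0,1,\dots,d-1\}$; $\mathcal A_d^n$ is the set of strings $x=x_1\cdots x_n$ over $\mathcal A_d$; $\oplus$ is concatenation. The directed de Bruijn graph $\vec{\mathcal B}(d,n)$ has vertex set $\mathcal A_d^n$ and an arc from $x_1\cdots x_n$ to $y_1\cdots y_n$ iff $x_2\cdots x_n=y_1\cdots y_{n-1}$. $\vec d(u,v)$ is the length of a shortest directed walk from $u$ to $v$; $B_t^-(v)=\{u:\vec d(u,v)\le t\}$; for $S\subseteq V$, $\mathrm{ID}_S(v)=B_t^-(v)\cap S$; a $t$-identifying code is a set $S$ with $\mathrm{ID}_S(v)\ne\emptyset$ for all $v$ and $\mathrm{ID}_S(u)\ne\mathrm{ID}_S(v)$ for all $u\ne v$. -}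

module Defs where

open import Data.Nat using (ℕ; zero; suc; _+_)
open import Data.Fin using (Fin; _≟_)
open import Data.Fin.Properties using () 
open import Data.Vec using (Vec; []; _∷_; _∷ʳ_; head; last)
open import Data.List using (List; [_]; concatMap; map)
open import Data.Nat.ListAction using (sum)
open import Data.List.Base using (allFin)
open import Data.Bool using (Bool; true; false; T; not; if_then_else_)
open import Data.Product using (Σ; _×_; ∃)
open import Data.Sum using (_⊎_)
open import Data.Unit using (⊤)
open import Data.Empty using (⊥)
open import Relation.Nullary using (¬_)
open import Relation.Nullary.Decidable using (⌊_⌋)
open import Relation.Binary.PropositionalEquality using (_≡_; _≢_)
open import Function.Bundles using (_⇔_)

-- Strings of length n over the alphabet A_d = Fin d  (vertices of B(d,n))
Word : ℕ → ℕ → Set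
Word d n = Vec (Fin d) n

-- Arc x → y of the directed de Bruijn graph: x₂⋯xₙ = y₁⋯y_{n-1},
-- i.e. x = a ⊕ w and y = w ⊕ b.  (For n = 0 the condition is vacuous.)
Arc : ∀ {d n} → Word d n → Word d n → Set
Arc {d} {zero}  x y = ⊤
Arc {d} {suc m} x y =
  Σ (Fin d) λ a → Σ (Fin d) λ b → Σ (Vec (Fin d) m) λ w →
    (x ≡ a ∷ w) × (y ≡ w ∷ʳ b)

-- u ∈ B₁⁻(v)  ⇔  d⃗(u,v) ≤ 1  ⇔  u = v or there is an arc u → v
InBall1 : ∀ {d n} → Word d n → Word d n → Set
InBall1 u v = (u ≡ v) ⊎ Arc u v

Subset : ℕ → ℕ → Set
Subset d n = Word d n → Bool

-- w ∈ ID_C(v) = B₁⁻(v) ∩ C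
InID : ∀ {d n} → Subset d n → Word d n → Word d n → Set
InID C v w = T (C w) × InBall1 w v

IsIdentifyingCode1 : ∀ {d n} → Subset d n → Set
IsIdentifyingCode1 {d} {n} C =
  (∀ (v : Word d n) → ∃ λ u → InID C v u) ×
  (∀ (u v : Word d n) → u ≢ v →
     ¬ (∀ (w : Word d n) → (InID C u w ⇔ InID C v w)))

allWords : ∀ d n → List (Word d n)
allWords d zero    = [ [] ]
allWords d (suc n) = concatMap (λ a → map (a ∷_) (allWords d n)) (allFin d)

size : ∀ {d n} → Subset d n → ℕ
size {d} {n} C = sum (map (λ x → if C x then 1 else 0) (allWords d n))

-- the code S = A_d^n minus { x : x₁ = xₙ }  (only used for n ≥ 1;
-- for n = 0 it is taken to be empty, irrelevant since n ≥ 2)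
codeS : ∀ {d n} → Subset d n
codeS {d} {zero}  x = false
codeS {d} {suc m} x = not ⌊ head x ≟ last x ⌋

-- The in-neighbours of a word p ⊕ b are the words a ⊕ p, so they depend
-- only on the prefix p.  Call the d words p ⊕ b (b ∈ A_d) the twin class
-- of p.  The proof rests on three observations.
--
-- Summing over all words is summing over twin classes; the
--    size of a code is therefore the sum of its class intersections.
--  * Lower bound.  Two twins outside a code C have the same in-neighbours,
--    hence the same ID sets; so an identifying code misses at most one
--    word of each of the d^(n-1) twin classes and has ≥ (d-1)d^(n-1) words.
--  * S attains it: in the class of a ⊕ w exactly the word a ⊕ w ⊕ a is
--    missing.  S separates twins because an arc between twins only starts
--    at a word with x₁ = xₙ.  For words with different prefixes q ≠ p,
--    equal ID sets force every codeword in-neighbour a ⊕ q (a ≠ last q)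
--    of q ⊕ c to be p ⊕ b itself: impossible for two letters a when d > 2,
--    and for odd n it forces q to alternate and end with a.

module Submission where

open import Defs
open import Data.Nat using (ℕ; zero; suc; _≤_; _<_; _∸_; _*_; _^_; _%_; _+_; z≤n; s≤s)
open import Data.Nat.Properties
  using (*-comm; *-assoc; *-identityʳ; +-identityʳ; +-mono-≤; ≤-refl; m∸n≤m; module ≤-Reasoning)
open import Data.Nat.ListAction using (sum)
open import Data.Nat.ListAction.Properties using (sum-++)
open import Data.List using (List; []; _∷_; map; concatMap; allFin; _++_)
open import Data.List.Properties using (map-cong; map-∘; map-++; map-tabulate)
open import Data.Fin using (Fin; zero; suc; _≟_)
open import Data.Fin.Properties using (any?)
open import Data.Vec using (Vec; []; _∷_; _∷ʳ_; head; last; initLast)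
open import Data.Vec.Properties using (∷-injectiveˡ; ∷-injectiveʳ; ∷ʳ-injectiveˡ; ∷ʳ-injectiveʳ; last-∷ʳ; ≡-dec)
open import Data.Bool using (Bool; true; false; T; not; if_then_else_)
open import Data.Bool.Properties using () renaming (_≟_ to _≟ᵇ_)
open import Data.Product using (_×_; _,_; ∃; ∃₂; proj₂)
open import Data.Sum using (_⊎_; inj₁; inj₂)
open import Data.Empty using (⊥; ⊥-elim)
open import Function using (_∘_)
open import Function.Bundles using (_⇔_; Equivalence)
open import Relation.Nullary using (¬_; yes; no)
open import Relation.Nullary.Decidable using (⌊_⌋; fromWitnessFalse)
open import Relation.Binary.PropositionalEquality
  using (_≡_; _≢_; refl; sym; trans; cong; module ≡-Reasoning)

𝟙 : Bool → ℕ
𝟙 b = if b then 1 else 0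

sum-concatMap : ∀ {A B : Set} (f : B → ℕ) (g : A → List B) (xs : List A) →
  sum (map f (concatMap g xs)) ≡ sum (map (λ x → sum (map f (g x))) xs)
sum-concatMap f g [] = refl
sum-concatMap f g (x ∷ xs) = begin
  sum (map f (g x ++ concatMap g xs))               ≡⟨ cong sum (map-++ f (g x) _) ⟩
  sum (map f (g x) ++ map f (concatMap g xs))       ≡⟨ sum-++ (map f (g x)) _ ⟩
  sum (map f (g x)) + sum (map f (concatMap g xs))  ≡⟨ cong (_ +_) (sum-concatMap f g xs) ⟩
  sum (map f (g x)) + sum (map (λ y → sum (map f (g y))) xs) ∎
  where open ≡-Reasoning

sum-mono : ∀ {A : Set} {f g : A → ℕ} → (∀ x → f x ≤ g x) → ∀ xs → sum (map f xs) ≤ sum (map g xs)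
sum-mono f≤g []       = z≤n
sum-mono f≤g (x ∷ xs) = +-mono-≤ (f≤g x) (sum-mono f≤g xs)

sumFin : (d : ℕ) → (Fin d → ℕ) → ℕ
sumFin d f = sum (map f (allFin d))

sumFin-suc : ∀ d (f : Fin (suc d) → ℕ) → sumFin (suc d) f ≡ f zero + sumFin d (f ∘ suc)
sumFin-suc d f = cong (λ xs → f zero + sum xs)
  (trans (map-tabulate suc f) (sym (map-tabulate (λ i → i) (f ∘ suc))))

sumFin-cong : ∀ {d} {f g : Fin d → ℕ} → (∀ b → f b ≡ g b) → sumFin d f ≡ sumFin d g
sumFin-cong {d} f≡g = cong sum (map-cong f≡g (allFin d))

sumFin-const : ∀ d k (f : Fin d → ℕ) → (∀ b → f b ≡ k) → sumFin d f ≡ d * k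
sumFin-const zero    k f f≡k = refl
sumFin-const (suc d) k f f≡k = begin
  sumFin (suc d) f          ≡⟨ sumFin-suc d f ⟩
  f zero + sumFin d (f ∘ suc) ≡⟨ cong (f zero +_) (sumFin-const d k (f ∘ suc) (f≡k ∘ suc)) ⟩
  f zero + d * k            ≡⟨ cong (_+ d * k) (f≡k zero) ⟩
  suc d * k                 ∎
  where open ≡-Reasoning

differsFrom : ∀ {d} → Fin d → Fin d → ℕ
differsFrom b₀ b = 𝟙 (not ⌊ b₀ ≟ b ⌋)

differsFrom-suc : ∀ {d} (b₀ b : Fin d) → differsFrom (suc b₀) (suc b) ≡ differsFrom b₀ b
differsFrom-suc b₀ b with b₀ ≟ b
... | yes _ = refl
... | no  _ = refl

sum-differsFrom : ∀ d (b₀ : Fin d) → sumFin d (differsFrom b₀) ≡ d ∸ 1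
sum-differsFrom (suc d) zero = begin
  sumFin (suc d) (differsFrom zero)  ≡⟨ sumFin-suc d (differsFrom zero) ⟩
  0 + sumFin d (λ _ → 1)             ≡⟨ sumFin-const d 1 _ (λ _ → refl) ⟩
  d * 1                              ≡⟨ *-identityʳ d ⟩
  d                                  ∎
  where open ≡-Reasoning
sum-differsFrom (suc (suc d)) (suc b₀) = begin
  sumFin (suc (suc d)) (differsFrom (suc b₀))        ≡⟨ sumFin-suc (suc d) (differsFrom (suc b₀)) ⟩
  1 + sumFin (suc d) (differsFrom (suc b₀) ∘ suc)    ≡⟨ cong suc (sumFin-cong (differsFrom-suc b₀)) ⟩
  1 + sumFin (suc d) (differsFrom b₀)                ≡⟨ cong suc (sum-differsFrom (suc d) b₀) ⟩
  suc d                                              ∎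
  where open ≡-Reasoning

count-lb : ∀ d (f : Fin d → Bool) → (∀ b b' → b ≢ b' → f b ≡ false → f b' ≡ false → ⊥) →
  d ∸ 1 ≤ sumFin d (𝟙 ∘ f)
count-lb d f falseOnce with any? (λ b → f b ≟ᵇ false)
... | yes (b₀ , fb₀) = begin
  d ∸ 1                  ≡⟨ sum-differsFrom d b₀ ⟨
  sumFin d (differsFrom b₀) ≤⟨ sum-mono below (allFin d) ⟩
  sumFin d (𝟙 ∘ f)        ∎
  where
  open ≤-Reasoning
  below : ∀ b → differsFrom b₀ b ≤ 𝟙 (f b)
  below b with b₀ ≟ b | f b in fb
  ... | yes _     | _     = z≤n
  ... | no  _     | true  = ≤-refl
  ... | no  b₀≢b  | false = ⊥-elim (falseOnce b₀ b b₀≢b fb₀ fb)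
... | no neverFalse = begin
  d ∸ 1            ≤⟨ m∸n≤m d 1 ⟩
  d                ≡⟨ *-identityʳ d ⟨
  d * 1            ≡⟨ sumFin-const d 1 (λ _ → 1) (λ _ → refl) ⟨
  sumFin d (λ _ → 1) ≤⟨ sum-mono one (allFin d) ⟩
  sumFin d (𝟙 ∘ f)  ∎
  where
  open ≤-Reasoning
  one : ∀ b → 1 ≤ 𝟙 (f b)
  one b with f b in fb
  ... | true  = ≤-refl
  ... | false = ⊥-elim (neverFalse (b , fb))

sumWords : ∀ d m → (Word d m → ℕ) → ℕ
sumWords d m f = sum (map f (allWords d m))

sumWords-cons : ∀ d m (f : Word d (suc m) → ℕ) →
  sumWords d (suc m) f ≡ sumFin d (λ a → sumWords d m (f ∘ (a ∷_)))
sumWords-cons d m f = trans (sum-concatMap f _ (allFin d))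
  (sumFin-cong (λ a → cong sum (sym (map-∘ {g = f} {f = a ∷_} (allWords d m)))))

-- Grouping by twin classes: the prefix w and the last letter b.
sumWords-snoc : ∀ d m (f : Word d (suc m) → ℕ) →
  sumWords d (suc m) f ≡ sumWords d m (λ w → sumFin d (λ b → f (w ∷ʳ b)))
sumWords-snoc d zero f = begin
  sumWords d 1 f                   ≡⟨ sumWords-cons d 0 f ⟩
  sumFin d (λ b → f (b ∷ []) + 0)  ≡⟨ sumFin-cong (λ b → +-identityʳ (f (b ∷ []))) ⟩
  sumFin d (λ b → f (b ∷ []))      ≡⟨ +-identityʳ _ ⟨
  sumFin d (λ b → f (b ∷ [])) + 0  ∎
  where open ≡-Reasoning
sumWords-snoc d (suc m) f = begin
  sumWords d (suc (suc m)) f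
    ≡⟨ sumWords-cons d (suc m) f ⟩
  sumFin d (λ a → sumWords d (suc m) (f ∘ (a ∷_)))
    ≡⟨ sumFin-cong (λ a → sumWords-snoc d m (f ∘ (a ∷_))) ⟩
  sumFin d (λ a → sumWords d m (λ w → sumFin d (λ b → f (a ∷ (w ∷ʳ b)))))
    ≡⟨ sumWords-cons d m _ ⟨
  sumWords d (suc m) (λ w → sumFin d (λ b → f (w ∷ʳ b)))
    ∎
  where open ≡-Reasoning

sumWords-const : ∀ d m k (f : Word d m → ℕ) → (∀ x → f x ≡ k) → sumWords d m f ≡ d ^ m * k
sumWords-const d zero    k f f≡k = cong (_+ 0) (f≡k [])
sumWords-const d (suc m) k f f≡k = begin
  sumWords d (suc m) f                     ≡⟨ sumWords-cons d m f ⟩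
  sumFin d (λ a → sumWords d m (f ∘ (a ∷_))) ≡⟨ sumFin-const d _ _ (λ a → sumWords-const d m k _ (f≡k ∘ (a ∷_))) ⟩
  d * (d ^ m * k)                          ≡⟨ *-assoc d (d ^ m) k ⟨
  d ^ suc m * k                            ∎
  where open ≡-Reasoning

sumWords-lb : ∀ d m k (f : Word d m → ℕ) → (∀ x → k ≤ f x) → d ^ m * k ≤ sumWords d m f
sumWords-lb d m k f k≤f = begin
  d ^ m * k              ≡⟨ sumWords-const d m k (λ _ → k) (λ _ → refl) ⟨
  sumWords d m (λ _ → k) ≤⟨ sum-mono k≤f (allWords d m) ⟩
  sumWords d m f         ∎
  where open ≤-Reasoning

arc-shift : ∀ {d m} (a : Fin d) (q : Vec (Fin d) m) c → Arc (a ∷ q) (q ∷ʳ c)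
arc-shift a q c = a , c , q , refl , refl

arc-tail : ∀ {d m} {a b : Fin d} {q p : Vec (Fin d) m} → Arc (a ∷ q) (p ∷ʳ b) → q ≡ p
arc-tail {p = p} (_ , _ , w , aq≡ , pb≡) = trans (∷-injectiveʳ aq≡) (sym (∷ʳ-injectiveˡ p w pb≡))

arc-twin : ∀ {d m} {x : Word d (suc m)} {w : Vec (Fin d) m} {b b'} → Arc x (w ∷ʳ b) → Arc x (w ∷ʳ b')
arc-twin {w = w} (a , _ , v , x≡ , wb≡) = a , _ , v , x≡ , cong (_∷ʳ _) (∷ʳ-injectiveˡ w v wb≡)

-- A word equal to its own shift is constant; in particular its ends agree.
shift-fixed : ∀ {A : Set} {m} (a : A) (p : Vec A m) b → a ∷ p ≡ p ∷ʳ b → a ≡ b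
shift-fixed a []      b eq = ∷-injectiveˡ eq
shift-fixed a (x ∷ p) b eq = trans (∷-injectiveˡ eq) (shift-fixed x p b (∷-injectiveʳ eq))

arc-between-twins : ∀ {d m} {p : Vec (Fin d) m} {b c} → Arc (p ∷ʳ b) (p ∷ʳ c) → head (p ∷ʳ b) ≡ last (p ∷ʳ b)
arc-between-twins {p = p} {b} (a , _ , w , pb≡ , pc≡) rewrite ∷ʳ-injectiveˡ p w pc≡ =
  trans (cong head pb≡) (trans (shift-fixed a w b (sym pb≡)) (sym (last-∷ʳ b w)))

codeword-arc : ∀ {d n} (C : Subset d n) {u v : Word d n} → T (C u) → u ≢ v →
  (∀ w → InID C u w → InID C v w) → Arc u v
codeword-arc C {u} u∈C u≢v sub with proj₂ (sub u (u∈C , inj₁ refl))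
... | inj₁ u≡v = ⊥-elim (u≢v u≡v)
... | inj₂ arc = arc

twins-outside-same-ID : ∀ {d m} (C : Subset d (suc m)) (w : Vec (Fin d) m) {b b'} →
  C (w ∷ʳ b) ≡ false → ∀ z → InID C (w ∷ʳ b) z → InID C (w ∷ʳ b') z
twins-outside-same-ID C w Cwb≡false z (z∈C , inj₁ refl) rewrite Cwb≡false = ⊥-elim z∈C
twins-outside-same-ID C w Cwb≡false z (z∈C , inj₂ arc) = z∈C , inj₂ (arc-twin arc)

identifying-misses-one : ∀ {d m} (C : Subset d (suc m)) → IsIdentifyingCode1 C → (w : Vec (Fin d) m) →
  ∀ b b' → b ≢ b' → C (w ∷ʳ b) ≡ false → C (w ∷ʳ b') ≡ false → ⊥
identifying-misses-one C (_ , separates) w b b' b≢b' Cwb Cwb' =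
  separates (w ∷ʳ b) (w ∷ʳ b') (b≢b' ∘ ∷ʳ-injectiveʳ w w) λ z → record
    { to        = twins-outside-same-ID C w Cwb z
    ; from      = twins-outside-same-ID C w Cwb' z
    ; to-cong   = λ { refl → refl }
    ; from-cong = λ { refl → refl }
    }

identifying-lb : ∀ d m (C : Subset d (suc m)) → IsIdentifyingCode1 C → (d ∸ 1) * d ^ m ≤ size C
identifying-lb d m C isCode = begin
  (d ∸ 1) * d ^ m   ≡⟨ *-comm (d ∸ 1) (d ^ m) ⟩
  d ^ m * (d ∸ 1)   ≤⟨ sumWords-lb d m (d ∸ 1) _ perClass ⟩
  sumWords d m (λ w → sumFin d (λ b → 𝟙 (C (w ∷ʳ b)))) ≡⟨ sumWords-snoc d m (𝟙 ∘ C) ⟨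
  size C            ∎
  where
  open ≤-Reasoning
  perClass : ∀ w → d ∸ 1 ≤ sumFin d (λ b → 𝟙 (C (w ∷ʳ b)))
  perClass w = count-lb d (λ b → C (w ∷ʳ b)) (identifying-misses-one C isCode w)

-- S meets the twin class of a ⊕ w in all words but a ⊕ w ⊕ a, so |S| = (d-1)·d^(n-1).
codeS-size : ∀ d m → size {d} {2 + m} codeS ≡ (d ∸ 1) * d ^ suc m
codeS-size d m = begin
  size {d} {2 + m} codeS                                    ≡⟨ sumWords-snoc d (suc m) (𝟙 ∘ codeS) ⟩
  sumWords d (suc m) (λ w → sumFin d (λ b → 𝟙 (codeS (w ∷ʳ b)))) ≡⟨ sumWords-const d (suc m) (d ∸ 1) _ perClass ⟩
  d ^ suc m * (d ∸ 1)                                       ≡⟨ *-comm (d ^ suc m) (d ∸ 1) ⟩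
  (d ∸ 1) * d ^ suc m                                       ∎
  where
  open ≡-Reasoning
  perClass : ∀ (w : Vec (Fin d) (suc m)) → sumFin d (λ b → 𝟙 (codeS (w ∷ʳ b))) ≡ d ∸ 1
  perClass (a ∷ w) = trans (sumFin-cong (λ b → cong (λ z → 𝟙 (not ⌊ a ≟ z ⌋)) (last-∷ʳ b w)))
                           (sum-differsFrom d a)

-- A word whose first and last letters differ lies in S (T (codeS x) is by
-- definition the failure of the test head x ≟ last x).
∈S : ∀ {d m} {x : Word d (suc m)} → head x ≢ last x → T (codeS x)
∈S = fromWitnessFalse

OtherLetter : ℕ → Set
OtherLetter d = (x : Fin d) → ∃ λ a → a ≢ x

TwoOtherLetters : ℕ → Set
TwoOtherLetters d = (x : Fin d) → ∃₂ λ a₁ a₂ → a₁ ≢ a₂ × a₁ ≢ x × a₂ ≢ x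

otherLetter : ∀ {d} → 1 < d → OtherLetter d
otherLetter (s≤s (s≤s z≤n)) zero    = suc zero , λ ()
otherLetter (s≤s (s≤s z≤n)) (suc _) = zero , λ ()

twoOtherLetters : ∀ {d} → 2 < d → TwoOtherLetters d
twoOtherLetters (s≤s (s≤s (s≤s z≤n))) zero          = suc zero , suc (suc zero) , (λ ()) , (λ ()) , (λ ())
twoOtherLetters (s≤s (s≤s (s≤s z≤n))) (suc zero)    = zero , suc (suc zero) , (λ ()) , (λ ()) , (λ ())
twoOtherLetters (s≤s (s≤s (s≤s z≤n))) (suc (suc _)) = zero , suc zero , (λ ()) , (λ ()) , (λ ())

data Odd : ℕ → Set where
  one : Odd 1
  2+  : ∀ {n} → Odd n → Odd (2 + n)

odd : ∀ n → n % 2 ≡ 1 → Odd n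
odd 1             _     = one
odd (suc (suc n)) n%2≡1 = 2+ (odd n n%2≡1)

-- If x ⊕ q = p ⊕ b and y ⊕ p = q ⊕ c, then q = y x y x …; for an odd word
-- length 2 + j (so q has even length) this means q ends with x.
alternating : ∀ {A : Set} {j} → Odd (2 + j) → ∀ {x y b c : A} {q p : Vec A (suc j)} →
  x ∷ q ≡ p ∷ʳ b → y ∷ p ≡ q ∷ʳ c → last q ≡ x
alternating (2+ one) {q = _ ∷ _ ∷ []} {p = _ ∷ _ ∷ []} refl refl = refl
alternating {A} (2+ (2+ odd)) {q = q₁ ∷ q₂ ∷ q} {p = p₁ ∷ p₂ ∷ p} xq≡ yp≡ =
  trans (alternating (2+ odd) (drop2 xq≡) (drop2 yp≡))
        (trans (sym (second yp≡)) (sym (∷-injectiveˡ xq≡)))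
  where
  drop2 : ∀ {k} {u₁ u₂ v₁ v₂ : A} {u v : Vec A k} → u₁ ∷ u₂ ∷ u ≡ v₁ ∷ v₂ ∷ v → u ≡ v
  drop2 eq = ∷-injectiveʳ (∷-injectiveʳ eq)
  second : ∀ {k} {u₁ u₂ v₁ v₂ : A} {u v : Vec A k} → u₁ ∷ u₂ ∷ u ≡ v₁ ∷ v₂ ∷ v → u₂ ≡ v₂
  second eq = ∷-injectiveˡ (∷-injectiveʳ eq)

inNeighbour∈ID : ∀ {d m} (q : Vec (Fin d) (suc m)) c a → a ≢ last q → InID codeS (q ∷ʳ c) (a ∷ q)
inNeighbour∈ID q c a a≢ = ∈S {x = a ∷ q} a≢ , inj₂ (arc-shift a q c)

-- A twin in S lies in its own ID set but not in that of another twin,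
-- since an arc between twins starts at a word outside S.
twin∈S-separated : ∀ {d m} (p : Vec (Fin d) m) {b c} → b ≢ c → head (p ∷ʳ b) ≢ last (p ∷ʳ b) →
  ¬ (∀ w → InID codeS (p ∷ʳ b) w → InID codeS (p ∷ʳ c) w)
twin∈S-separated p {b} b≢c ends≢ sub =
  ends≢ (arc-between-twins (codeword-arc codeS (∈S {x = p ∷ʳ b} ends≢) (b≢c ∘ ∷ʳ-injectiveʳ p p) sub))

-- S separates distinct twins: if neither is in S, both end with the common first letter.
twins-separated : ∀ {d m} (p : Vec (Fin d) (suc m)) {b c} → b ≢ c →
  ¬ (∀ w → InID codeS (p ∷ʳ b) w ⇔ InID codeS (p ∷ʳ c) w)
twins-separated p {b} {c} b≢c sameID
  with head (p ∷ʳ b) ≟ last (p ∷ʳ b) | head (p ∷ʳ c) ≟ last (p ∷ʳ c)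
... | no ends≢ | _        = twin∈S-separated p b≢c ends≢ (Equivalence.to ∘ sameID)
... | _        | no ends≢ = twin∈S-separated p (b≢c ∘ sym) ends≢ (Equivalence.from ∘ sameID)
... | yes endsb | yes endsc = b≢c (begin
  b                ≡⟨ last-∷ʳ b p ⟨
  last (p ∷ʳ b)    ≡⟨ endsb ⟨
  head (p ∷ʳ b)    ≡⟨ sameHead p ⟩
  head (p ∷ʳ c)    ≡⟨ endsc ⟩
  last (p ∷ʳ c)    ≡⟨ last-∷ʳ c p ⟩
  c                ∎)
  where
  open ≡-Reasoning
  sameHead : ∀ {k} (p : Vec _ (suc k)) → head (p ∷ʳ b) ≡ head (p ∷ʳ c)
  sameHead (_ ∷ _) = refl

forced-equal : ∀ {d m} (p q : Vec (Fin d) (suc m)) b c → p ≢ q →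
  (∀ w → InID codeS (q ∷ʳ c) w → InID codeS (p ∷ʳ b) w) →
  ∀ a → a ≢ last q → a ∷ q ≡ p ∷ʳ b
forced-equal p q b c p≢q sub a a≢ with proj₂ (sub (a ∷ q) (inNeighbour∈ID q c a a≢))
... | inj₁ aq≡pb = aq≡pb
... | inj₂ arc   = ⊥-elim (p≢q (sym (arc-tail arc)))

prefixes-separated : ∀ {d m} → OtherLetter d → Odd (2 + m) ⊎ TwoOtherLetters d →
  (p q : Vec (Fin d) (suc m)) → ∀ b c → p ≢ q →
  ¬ (∀ w → InID codeS (p ∷ʳ b) w ⇔ InID codeS (q ∷ʳ c) w)
prefixes-separated {d} {m} other oddOrLarge p q b c p≢q sameID = contradiction oddOrLarge
  where
  qForced : ∀ a → a ≢ last q → a ∷ q ≡ p ∷ʳ b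
  qForced = forced-equal p q b c p≢q (Equivalence.from ∘ sameID)
  pForced : ∀ a → a ≢ last p → a ∷ p ≡ q ∷ʳ c
  pForced = forced-equal q p c b (p≢q ∘ sym) (Equivalence.to ∘ sameID)
  contradiction : Odd (2 + m) ⊎ TwoOtherLetters d → ⊥
  contradiction (inj₁ n-odd) with other (last q) | other (last p)
  ... | a , a≢ | a' , a'≢ = a≢ (sym (alternating n-odd (qForced a a≢) (pForced a' a'≢)))
  contradiction (inj₂ two) with two (last q)
  ... | a₁ , a₂ , a₁≢a₂ , a₁≢ , a₂≢ = a₁≢a₂ (∷-injectiveˡ (trans (qForced a₁ a₁≢) (sym (qForced a₂ a₂≢))))

codeS-identifying : ∀ {d m} → OtherLetter d → Odd (2 + m) ⊎ TwoOtherLetters d →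
  IsIdentifyingCode1 {d} {2 + m} codeS
codeS-identifying {d} {m} other oddOrLarge = nonempty , separated
  where
  nonempty : ∀ (v : Word d (2 + m)) → ∃ λ u → InID codeS v u
  nonempty v with initLast v
  ... | q , c , refl with other (last q)
  ...   | a , a≢ = a ∷ q , inNeighbour∈ID q c a a≢
  separated : ∀ (u v : Word d (2 + m)) → u ≢ v → ¬ (∀ w → InID codeS u w ⇔ InID codeS v w)
  separated u v u≢v with initLast u | initLast v
  ... | p , b , refl | q , c , refl with ≡-dec _≟_ p q
  ...   | yes refl = twins-separated p (u≢v ∘ cong (p ∷ʳ_))
  ...   | no  p≢q  = prefixes-separated other oddOrLarge p q b c p≢q

theorem3p14 : (d n : ℕ) → 2 ≤ d → 2 ≤ n →
    (n % 2 ≡ 1 ⊎ (n % 2 ≡ 0 × 2 < d)) →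
    IsIdentifyingCode1 {d} {n} codeS ×
    size {d} {n} codeS ≡ (d ∸ 1) * d ^ (n ∸ 1) ×
    (∀ (C : Subset d n) → IsIdentifyingCode1 C → (d ∸ 1) * d ^ (n ∸ 1) ≤ size C)
theorem3p14 d (suc (suc m)) 2≤d _ parity =
  codeS-identifying (otherLetter 2≤d) (oddOrLarge parity) , codeS-size d m , identifying-lb d (suc m)
  where
  oddOrLarge : (2 + m) % 2 ≡ 1 ⊎ ((2 + m) % 2 ≡ 0 × 2 < d) → Odd (2 + m) ⊎ TwoOtherLetters d
  oddOrLarge (inj₁ n-odd)     = inj₁ (odd (2 + m) n-odd)
  oddOrLarge (inj₂ (_ , 2<d)) = inj₂ (twoOtherLetters 2<d)
theorem3p14 d 1 _ (s≤s ()) _
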